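{- Let $X$ be a pairwise balanced design and let $f$ be a regular element of the Wilson monoid $W(X)$. Then the image of $f$ is a subsystem of $X$.
   Context: A PBD is a pair $(S,\mathcal{L})$ with $S$ finite and $\mathcal{L}$ a set of subsets (blocks) of size at least 2 such that every pair of distinct points lies in exactly one block (degenerate cases with fewer than two blocks excluded). A subsystem is a set $F\subseteq S$ such that for all distinct $x,y\in F$ the block containing them is contained in $F$. For a partial function $f:S\to S$ put $f^{ -w}(B)=f^{ -1}(B)\cup(S\setminus Dom(f))$. $W(X)$ is the monoid under composition of all partial functions $f:S\to S$ such that $f^{ -w}(F)$ is a subsystem for every subsystem $F$. An element $f$ is regular if $fgf=f$ for some $g\in W(X)$. -}

module Defs where

open import Level using (0ℓ)
open import Data.Nat using (ℕ; _≥_)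
open import Data.Fin using (Fin)
open import Data.Fin.Subset using (Subset; _∈_; ∣_∣)
open import Data.Maybe using (Maybe; just; nothing; _>>=_)
open import Data.List using (List)
import Data.List.Membership.Propositional as LM
open import Data.Product using (Σ; ∃; _×_)
open import Data.Sum using (_⊎_)
open import Relation.Nullary using (¬_)
open import Relation.Unary using (Pred)
open import Relation.Binary.PropositionalEquality using (_≡_; _≢_)

-- A pairwise balanced design on the point set S = Fin n.
-- Blocks are a finite list of subsets of S (duplicates irrelevant:
-- uniqueness is stated as equality of subsets).
record PBD : Set where
  field
    n       : ℕ
    blocks  : List (Subset n)
    size≥2  : ∀ B → B LM.∈ blocks → ∣ B ∣ ≥ 2
    cover   : ∀ (x y : Fin n) → x ≢ y →
              Σ (Subset n) λ B → B LM.∈ blocks × x ∈ B × y ∈ B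
    unique  : ∀ (x y : Fin n) → x ≢ y → ∀ B B' →
              B LM.∈ blocks → x ∈ B → y ∈ B →
              B' LM.∈ blocks → x ∈ B' → y ∈ B' → B ≡ B'
    twoBlocks : Σ (Subset n) λ B → Σ (Subset n) λ B' →
                B LM.∈ blocks × B' LM.∈ blocks × B ≢ B'

module _ (X : PBD) where
  open PBD X

  Point : Set
  Point = Fin n

  -- subsets of S are represented as predicates on S
  IsSubsystem : Pred Point 0ℓ → Set
  IsSubsystem F = ∀ (x y : Point) → x ≢ y → F x → F y →
                  ∀ B → B LM.∈ blocks → x ∈ B → y ∈ B →
                  ∀ z → z ∈ B → F z

  PFun : Set
  PFun = Point → Maybe Point

  _⊚_ : PFun → PFun → PFun
  (f ⊚ g) x = g x >>= f

  weakPreimage : PFun → Pred Point 0ℓ → Pred Point 0ℓ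
  weakPreimage f F x = (f x ≡ nothing) ⊎ (∃ λ y → f x ≡ just y × F y)

  InW : PFun → Set₁
  InW f = ∀ (F : Pred Point 0ℓ) → IsSubsystem F → IsSubsystem (weakPreimage f F)

  IsRegular : PFun → Set₁
  IsRegular f = Σ PFun λ g → InW g × (∀ x → (f ⊚ (g ⊚ f)) x ≡ f x)

  image : PFun → Pred Point 0ℓ
  image f y = ∃ λ x → f x ≡ just y

module Submission where

-- Let f ∈ W(X) be regular, say f g f = f with g ∈ W(X), and put
-- h = f g  (first g, then f).  Then
--   * h ∈ W(X), because W(X) is closed under composition: the weak preimage
--     under a composite is the iterated weak preimage;
--   * the image of f is exactly the fixed-point set of h: a point f a is fixed
--     by h since f g f = f, and h x = x exhibits x as a value of f;
--   * consequently every value of h is a fixed point of h.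
-- So it suffices to show: the fixed-point set of any h ∈ W(X) all of whose
-- values are fixed is a subsystem.  Given fixed x ≠ y and z on their block B,
-- weak preimages of singletons and of B (both subsystems) force h z = z:
-- if h z were undefined, the weak preimage of {x} would contain x, z, hence y;
-- if h z = w, the weak preimage of B shows w ∈ B, and if w ≠ z the weak
-- preimage of {w} contains z and w, hence x and y, giving x = w = y.

open import Defs
open import Level using (0ℓ)
open import Data.Fin using (_≟_)
open import Data.Fin.Subset using (_∈_)
open import Data.Maybe using (just; nothing)
open import Data.Maybe.Properties using (just-injective)
import Data.List.Membership.Propositional as LM
open import Data.Product using (_,_)
open import Data.Sum using (inj₁; inj₂)
open import Data.Empty using (⊥; ⊥-elim)
open import Relation.Nullary using (yes; no)
open import Relation.Unary using (Pred)
open import Relation.Binary.PropositionalEquality using (_≡_; _≢_; refl; sym; trans; subst)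

just≢nothing : ∀ {A : Set} {a : A} → just a ≢ nothing
just≢nothing ()

module _ (X : PBD) where
  open PBD X

  subsystem-resp : ∀ {F G : Pred (Point X) 0ℓ} →
                   (∀ x → F x → G x) → (∀ x → G x → F x) →
                   IsSubsystem X F → IsSubsystem X G
  subsystem-resp F⇒G G⇒F sub x y x≢y Gx Gy B B∈ xB yB z zB =
    F⇒G z (sub x y x≢y (G⇒F x Gx) (G⇒F y Gy) B B∈ xB yB z zB)

  singleton-subsystem : ∀ p → IsSubsystem X (λ q → q ≡ p)
  singleton-subsystem p x y x≢y refl refl = ⊥-elim (x≢y refl)

  -- Every block is a subsystem: the block through two of its points is itself.
  block-subsystem : ∀ B → B LM.∈ blocks → IsSubsystem X (_∈ B)
  block-subsystem B B∈ x y x≢y xB yB B' B'∈ xB' yB' z zB' =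
    subst (z ∈_) (unique x y x≢y B' B B'∈ xB' yB' B∈ xB yB) zB'

  weakPreimage-⊚⁺ : ∀ f g F z → weakPreimage X (_⊚_ X f g) F z →
                    weakPreimage X g (weakPreimage X f F) z
  weakPreimage-⊚⁺ f g F z p with g z
  ... | nothing = inj₁ refl
  ... | just c with f c in fc
  ...   | nothing = inj₂ (c , refl , inj₁ fc)
  ...   | just _ with p
  ...     | inj₂ (q , refl , Fq) = inj₂ (c , refl , inj₂ (q , fc , Fq))

  weakPreimage-⊚⁻ : ∀ f g F z → weakPreimage X g (weakPreimage X f F) z →
                    weakPreimage X (_⊚_ X f g) F z
  weakPreimage-⊚⁻ f g F z p with g z
  ... | nothing = inj₁ refl
  ... | just c with p
  ...   | inj₂ (_ , refl , inj₁ fc) = inj₁ fc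
  ...   | inj₂ (_ , refl , inj₂ fc∈F) = inj₂ fc∈F

  InW-⊚ : ∀ f g → InW X f → InW X g → InW X (_⊚_ X f g)
  InW-⊚ f g fW gW F sub =
    subsystem-resp (weakPreimage-⊚⁻ f g F) (weakPreimage-⊚⁺ f g F) (gW _ (fW F sub))

  Fix : PFun X → Pred (Point X) 0ℓ
  Fix h x = h x ≡ just x

  Fix-subsystem : ∀ h → InW X h → (∀ z w → h z ≡ just w → Fix h w) →
                  IsSubsystem X (Fix h)
  Fix-subsystem h hW values-fixed x y x≢y hx hy B B∈ xB yB z zB
    with x ≟ z
  ... | yes refl = hx
  ... | no x≢z with h z in hz
  ...   | nothing = ⊥-elim undefined-impossible
    where
    -- The weak preimage of {x} contains x and z, hence y; but h y = y ≠ x.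
    undefined-impossible : ⊥
    undefined-impossible
      with hW _ (singleton-subsystem x) x z x≢z (inj₂ (x , hx , refl)) (inj₁ hz)
             B B∈ xB zB y yB
    ... | inj₁ hy-undef = just≢nothing (trans (sym hy) hy-undef)
    ... | inj₂ (_ , hy' , refl) = x≢y (just-injective (trans (sym hy') hy))
  ...   | just w with w ≟ z
  ...     | yes refl = refl
  ...     | no w≢z = ⊥-elim (x≢y (trans (collapse x hx xB) (sym (collapse y hy yB))))
    where
    -- The weak preimage of B contains x and y, hence z, so w = h z lies in B.
    w∈B : w ∈ B
    w∈B with hW _ (block-subsystem B B∈) x y x≢y (inj₂ (x , hx , xB)) (inj₂ (y , hy , yB))
               B B∈ xB yB z zB
    ... | inj₁ hz-undef = ⊥-elim (just≢nothing (trans (sym hz) hz-undef))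
    ... | inj₂ (q , hz' , q∈B) = subst (_∈ B) (just-injective (trans (sym hz') hz)) q∈B
    -- The weak preimage of {w} contains z and w, hence every fixed point of B
    -- is sent to w.
    collapse : ∀ t → Fix h t → t ∈ B → t ≡ w
    collapse t ht tB
      with hW _ (singleton-subsystem w) z w (λ z≡w → w≢z (sym z≡w))
             (inj₂ (w , hz , refl)) (inj₂ (w , values-fixed z w hz , refl))
             B B∈ zB w∈B t tB
    ... | inj₁ ht-undef = ⊥-elim (just≢nothing (trans (sym ht) ht-undef))
    ... | inj₂ (_ , ht' , refl) = just-injective (trans (sym ht) ht')

  -- For a regular f with f g f = f, the composite h = f g fixes exactly the
  -- image of f.
  module Regular (f g : PFun X) (fgf≡f : ∀ x → (_⊚_ X f (_⊚_ X g f)) x ≡ f x) where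

    h : PFun X
    h = _⊚_ X f g

    -- A value y = f a is fixed: h y = f (g (f a)) = f a = y.
    image⊆Fix : ∀ y → image X f y → Fix h y
    image⊆Fix y (a , fa≡y) with fgf≡f a
    ... | fgfa≡fa rewrite fa≡y = fgfa≡fa

    -- Every value of h is a value of f, since h applies f last.
    values⊆image : ∀ z w → h z ≡ just w → image X f w
    values⊆image z w hz≡w with g z
    ... | just c = c , hz≡w

    Fix⊆image : ∀ y → Fix h y → image X f y
    Fix⊆image y = values⊆image y y

    values-fixed : ∀ z w → h z ≡ just w → Fix h w
    values-fixed z w hz≡w = image⊆Fix w (values⊆image z w hz≡w)

corollary7p4 : (X : PBD) (f : PFun X) → InW X f → IsRegular X f → IsSubsystem X (image X f)
corollary7p4 X f fW (g , gW , fgf≡f) =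
  subsystem-resp X Fix⊆image image⊆Fix
    (Fix-subsystem X h (InW-⊚ X f g fW gW) values-fixed)
  where open Regular X f g fgf≡f
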